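{- For all formulas $\varphi,\psi$ over $\Sigma=\{\land,\lor,\to,\neg,\sim,\square\}$, the following are theorems of $IvFDE_T$: (1) $\square\varphi\to\sim\neg\varphi$; (2) $\square\varphi\leftrightarrow\square\neg\sim\varphi$; (3) $\square\varphi\leftrightarrow\square\neg\neg\varphi$; (4) $\square\neg\varphi\leftrightarrow\square\sim\varphi$; (5) $\square\sim\varphi\to\neg\varphi$; (6) $\square\neg(\varphi\lor\psi)\leftrightarrow\square(\neg\varphi\land\neg\psi)$; (7) $\square\neg(\varphi\to\psi)\leftrightarrow\square(\varphi\land\neg\psi)$; (8) $(\square\neg\varphi\lor\square\neg\psi)\to\square\neg(\varphi\land\psi)$; (9) $\square\varphi\to\neg\sim\varphi$; (10) $\neg\sim\varphi\to\sim\square\sim\varphi$.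
   Context: Formulas are built from a countable set of propositional variables using binary $\land,\lor,\to$ and unary $\neg,\sim,\square$. Write $\alpha\leftrightarrow\beta$ for $(\alpha\to\beta)\land(\beta\to\alpha)$. $IvFDE_T$ is the Hilbert calculus with modus ponens as the only rule and the following axiom schemas: - (Ax1) $\varphi\to(\psi\to\varphi)$; - (Ax2) $(\varphi\to(\psi\to\gamma))\to((\varphi\to\psi)\to(\varphi\to\gamma))$; - (Ax3) $\varphi\to(\psi\to(\varphi\land\psi))$; - (Ax4) $(\varphi\land\psi)\to\varphi$; - (Ax5) $(\varphi\land\psi)\to\psi$; - (Ax6) $\varphi\to(\varphi\lor\psi)$; - (Ax7) $\psi\to(\varphi\lor\psi)$; - (Ax8) $(\varphi\to\gamma)\to((\psi\to\gamma)\to((\varphi\lor\psi)\to\gamma))$; - $\neg\neg\varphi\leftrightarrow\varphi$; - $\neg(\varphi\lor\psi)\leftrightarrow(\neg\varphi\land\neg\psi)$; - $\neg(\varphi\land\psi)\leftrightarrow(\neg\varphi\lor\neg\psi)$; - $\neg(\varphi\to\psi)\leftrightarrow(\varphi\land\neg\psi)$; - $\varphi\lor(\varphi\to\psi)$; - $(\sim\psi\to\sim\varphi)\to((\sim\psi\to\varphi)\to\psi)$; - (K) $\square(\varphi\to\psi)\to(\square\varphi\to\square\psi)$; - (K1) $\square(\varphi\to\psi)\to(\square\sim\psi\to\square\sim\varphi)$; - (K2) $\square\sim(\varphi\to\psi)\leftrightarrow(\square\varphi\land\square\sim\psi)$; - (M1) $(\square\sim\varphi\lor\square\psi)\to\square(\varphi\to\psi)$;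 - (T) $\square\varphi\to\varphi$; - (DN1) $\square\varphi\leftrightarrow\square\sim\sim\varphi$; - (N1) $\square(\varphi\land\psi)\leftrightarrow(\square\varphi\land\square\psi)$; - (N2) $\square\sim(\varphi\lor\psi)\leftrightarrow\square(\sim\varphi\land\sim\psi)$; - (N3) $(\square\sim\varphi\lor\square\sim\psi)\to\square\sim(\varphi\land\psi)$; - (N4) $(\square\varphi\lor\square\psi)\to\square(\varphi\lor\psi)$; - (N5) $\square\varphi\leftrightarrow\square\sim\neg\varphi$; - (N6) $\square\sim\varphi\leftrightarrow\square\sim\neg\neg\varphi$; - (N7) $\square\sim(\varphi\land\psi)\to(\square\varphi\to\square\sim\psi)$; - (N8) $\square\sim(\varphi\land\psi)\to(\square\psi\to\square\sim\varphi)$; - (N9) $\square(\varphi\lor\psi)\to(\square\sim\varphi\to\square\psi)$; - (N10) $\square(\varphi\lor\psi)\to(\square\sim\psi\to\square\varphi)$. -}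

module Defs where

open import Data.Nat using (ℕ)

-- Formulas over Σ = {∧, ∨, →, ¬, ∼, □} built from countably many variables (indexed by ℕ).
-- ¬ is written ¬' (the "strong"/De Morgan negation), ∼ is written ∼.
infixr 5 _⇒_
infixr 6 _∨'_
infixr 7 _∧'_
data Form : Set where
  var  : ℕ → Form
  _∧'_ : Form → Form → Form
  _∨'_ : Form → Form → Form
  _⇒_  : Form → Form → Form
  ¬'_  : Form → Form
  ∼_   : Form → Form
  □_   : Form → Form

infix 4 _⇔_
_⇔_ : Form → Form → Form
α ⇔ β = (α ⇒ β) ∧' (β ⇒ α)

data Axiom : Form → Set where
  ax1  : ∀ φ ψ → Axiom (φ ⇒ (ψ ⇒ φ))
  ax2  : ∀ φ ψ γ → Axiom ((φ ⇒ (ψ ⇒ γ)) ⇒ ((φ ⇒ ψ) ⇒ (φ ⇒ γ)))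
  ax3  : ∀ φ ψ → Axiom (φ ⇒ (ψ ⇒ (φ ∧' ψ)))
  ax4  : ∀ φ ψ → Axiom ((φ ∧' ψ) ⇒ φ)
  ax5  : ∀ φ ψ → Axiom ((φ ∧' ψ) ⇒ ψ)
  ax6  : ∀ φ ψ → Axiom (φ ⇒ (φ ∨' ψ))
  ax7  : ∀ φ ψ → Axiom (ψ ⇒ (φ ∨' ψ))
  ax8  : ∀ φ ψ γ → Axiom ((φ ⇒ γ) ⇒ ((ψ ⇒ γ) ⇒ ((φ ∨' ψ) ⇒ γ)))
  negneg  : ∀ φ → Axiom ((¬' ¬' φ) ⇔ φ)
  negor   : ∀ φ ψ → Axiom ((¬' (φ ∨' ψ)) ⇔ ((¬' φ) ∧' (¬' ψ)))
  negand  : ∀ φ ψ → Axiom ((¬' (φ ∧' ψ)) ⇔ ((¬' φ) ∨' (¬' ψ)))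
  negimp  : ∀ φ ψ → Axiom ((¬' (φ ⇒ ψ)) ⇔ (φ ∧' (¬' ψ)))
  peirce  : ∀ φ ψ → Axiom (φ ∨' (φ ⇒ ψ))
  tnd     : ∀ φ ψ → Axiom (((∼ ψ) ⇒ (∼ φ)) ⇒ (((∼ ψ) ⇒ φ) ⇒ ψ))
  axK   : ∀ φ ψ → Axiom ((□ (φ ⇒ ψ)) ⇒ ((□ φ) ⇒ (□ ψ)))
  axK1  : ∀ φ ψ → Axiom ((□ (φ ⇒ ψ)) ⇒ ((□ (∼ ψ)) ⇒ (□ (∼ φ))))
  axK2  : ∀ φ ψ → Axiom ((□ (∼ (φ ⇒ ψ))) ⇔ ((□ φ) ∧' (□ (∼ ψ))))
  axM1  : ∀ φ ψ → Axiom (((□ (∼ φ)) ∨' (□ ψ)) ⇒ (□ (φ ⇒ ψ)))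
  axT   : ∀ φ → Axiom ((□ φ) ⇒ φ)
  axDN1 : ∀ φ → Axiom ((□ φ) ⇔ (□ (∼ (∼ φ))))
  axN1  : ∀ φ ψ → Axiom ((□ (φ ∧' ψ)) ⇔ ((□ φ) ∧' (□ ψ)))
  axN2  : ∀ φ ψ → Axiom ((□ (∼ (φ ∨' ψ))) ⇔ (□ ((∼ φ) ∧' (∼ ψ))))
  axN3  : ∀ φ ψ → Axiom (((□ (∼ φ)) ∨' (□ (∼ ψ))) ⇒ (□ (∼ (φ ∧' ψ))))
  axN4  : ∀ φ ψ → Axiom (((□ φ) ∨' (□ ψ)) ⇒ (□ (φ ∨' ψ)))
  axN5  : ∀ φ → Axiom ((□ φ) ⇔ (□ (∼ (¬' φ))))
  axN6  : ∀ φ → Axiom ((□ (∼ φ)) ⇔ (□ (∼ (¬' (¬' φ)))))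
  axN7  : ∀ φ ψ → Axiom ((□ (∼ (φ ∧' ψ))) ⇒ ((□ φ) ⇒ (□ (∼ ψ))))
  axN8  : ∀ φ ψ → Axiom ((□ (∼ (φ ∧' ψ))) ⇒ ((□ ψ) ⇒ (□ (∼ φ))))
  axN9  : ∀ φ ψ → Axiom ((□ (φ ∨' ψ)) ⇒ ((□ (∼ φ)) ⇒ (□ ψ)))
  axN10 : ∀ φ ψ → Axiom ((□ (φ ∨' ψ)) ⇒ ((□ (∼ ψ)) ⇒ (□ φ)))

data ⊢_ : Form → Set where
  axiom : ∀ {φ} → Axiom φ → ⊢ φ
  mp    : ∀ {φ ψ} → ⊢ (φ ⇒ ψ) → ⊢ φ → ⊢ ψ

-- Under □ the two negations coincide: N5 and N6 give □¬φ ⇔ □∼¬¬φ ⇔ □∼φ.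
-- With this, each ¬-law under □ is the corresponding ∼-law (DN1, N1–N3, K2)
-- read back through □¬ ⇔ □∼, and the unboxed items follow by T.  Item (10)
-- is the ∼-contrapositive of (1) at ∼φ, and ∼ is a classical
-- negation by the axiom (∼ψ → ∼φ) → ((∼ψ → φ) → ψ).
module Submission where

open import Defs
open import Data.Product using (_×_; _,_)
open import Data.List using (List; []; _∷_)
open import Data.List.Membership.Propositional using (_∈_)
open import Data.List.Relation.Unary.Any using (here; there)
open import Relation.Binary.PropositionalEquality using (refl)

infix 2 _⊩_
data _⊩_ (Γ : List Form) : Form → Set where
  hyp : ∀ {φ} → φ ∈ Γ → Γ ⊩ φ
  thm : ∀ {φ} → ⊢ φ → Γ ⊩ φ
  app : ∀ {φ ψ} → Γ ⊩ (φ ⇒ ψ) → Γ ⊩ φ → Γ ⊩ ψ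

hyp₀ : ∀ {Γ φ} → (φ ∷ Γ) ⊩ φ
hyp₀ = hyp (here refl)

hyp₁ : ∀ {Γ φ ψ} → (ψ ∷ φ ∷ Γ) ⊩ φ
hyp₁ = hyp (there (here refl))

⇒-refl : ∀ φ → ⊢ (φ ⇒ φ)
⇒-refl φ = mp (mp (axiom (ax2 φ (φ ⇒ φ) φ)) (axiom (ax1 φ (φ ⇒ φ)))) (axiom (ax1 φ φ))

deduction : ∀ {Γ φ ψ} → (φ ∷ Γ) ⊩ ψ → Γ ⊩ (φ ⇒ ψ)
deduction {φ = φ} (hyp (here refl))   = thm (⇒-refl φ)
deduction {φ = φ} (hyp {ψ} (there p)) = app (thm (axiom (ax1 ψ φ))) (hyp p)
deduction {φ = φ} (thm {ψ} t)         = thm (mp (axiom (ax1 ψ φ)) t)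
deduction {φ = φ} (app {χ} {ψ} d e)   =
  app (app (thm (axiom (ax2 φ χ ψ))) (deduction d)) (deduction e)

closed : ∀ {φ} → [] ⊩ φ → ⊢ φ
closed (hyp ())
closed (thm t)   = t
closed (app d e) = mp (closed d) (closed e)

⇒-trans : ∀ {α β γ} → ⊢ (α ⇒ β) → ⊢ (β ⇒ γ) → ⊢ (α ⇒ γ)
⇒-trans αβ βγ = closed (deduction (app (thm βγ) (app (thm αβ) hyp₀)))

⇔-intro : ∀ {α β} → ⊢ (α ⇒ β) → ⊢ (β ⇒ α) → ⊢ (α ⇔ β)
⇔-intro {α} {β} f g = mp (mp (axiom (ax3 (α ⇒ β) (β ⇒ α))) f) g

⇔-elimˡ : ∀ {α β} → ⊢ (α ⇔ β) → ⊢ (α ⇒ β)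
⇔-elimˡ {α} {β} e = mp (axiom (ax4 (α ⇒ β) (β ⇒ α))) e

⇔-elimʳ : ∀ {α β} → ⊢ (α ⇔ β) → ⊢ (β ⇒ α)
⇔-elimʳ {α} {β} e = mp (axiom (ax5 (α ⇒ β) (β ⇒ α))) e

⇔-refl : ∀ φ → ⊢ (φ ⇔ φ)
⇔-refl φ = ⇔-intro (⇒-refl φ) (⇒-refl φ)

⇔-sym : ∀ {α β} → ⊢ (α ⇔ β) → ⊢ (β ⇔ α)
⇔-sym e = ⇔-intro (⇔-elimʳ e) (⇔-elimˡ e)

infixr 4 _⟨⇔⟩_
_⟨⇔⟩_ : ∀ {α β γ} → ⊢ (α ⇔ β) → ⊢ (β ⇔ γ) → ⊢ (α ⇔ γ)
e ⟨⇔⟩ f = ⇔-intro (⇒-trans (⇔-elimˡ e) (⇔-elimˡ f)) (⇒-trans (⇔-elimʳ f) (⇔-elimʳ e))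

∧-mono : ∀ {α β α′ β′} → ⊢ (α ⇒ α′) → ⊢ (β ⇒ β′) → ⊢ ((α ∧' β) ⇒ (α′ ∧' β′))
∧-mono {α} {β} {α′} {β′} f g = closed (deduction
  (app (app (thm (axiom (ax3 α′ β′)))
            (app (thm f) (app (thm (axiom (ax4 α β))) hyp₀)))
       (app (thm g) (app (thm (axiom (ax5 α β))) hyp₀))))

∧-cong : ∀ {α β α′ β′} → ⊢ (α ⇔ α′) → ⊢ (β ⇔ β′) → ⊢ ((α ∧' β) ⇔ (α′ ∧' β′))
∧-cong e f = ⇔-intro (∧-mono (⇔-elimˡ e) (⇔-elimˡ f)) (∧-mono (⇔-elimʳ e) (⇔-elimʳ f))

∨-mono : ∀ {α β α′ β′} → ⊢ (α ⇒ α′) → ⊢ (β ⇒ β′) → ⊢ ((α ∨' β) ⇒ (α′ ∨' β′))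
∨-mono {α} {β} {α′} {β′} f g =
  mp (mp (axiom (ax8 α β (α′ ∨' β′))) (⇒-trans f (axiom (ax6 α′ β′))))
     (⇒-trans g (axiom (ax7 α′ β′)))

∼∼-elim : ∀ φ → ⊢ (∼ ∼ φ ⇒ φ)
∼∼-elim φ = closed (deduction
  (app (app (thm (axiom (tnd (∼ φ) φ))) (deduction hyp₁)) (thm (⇒-refl (∼ φ)))))

∼-contraposition : ∀ {α β} → ⊢ (α ⇒ ∼ β) → ⊢ (β ⇒ ∼ α)
∼-contraposition {α} {β} f = closed (deduction
  (app (app (thm (axiom (tnd β (∼ α)))) (thm (⇒-trans (∼∼-elim α) f))) (deduction hyp₁)))

□¬⇔□∼ : ∀ φ → ⊢ (□ ¬' φ ⇔ □ ∼ φ)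
□¬⇔□∼ φ = axiom (axN5 (¬' φ)) ⟨⇔⟩ ⇔-sym (axiom (axN6 φ))

□⇒∼¬ : ∀ φ → ⊢ (□ φ ⇒ ∼ ¬' φ)
□⇒∼¬ φ = ⇒-trans (⇔-elimˡ (axiom (axN5 φ))) (axiom (axT (∼ ¬' φ)))

□⇔□¬∼ : ∀ φ → ⊢ (□ φ ⇔ □ ¬' ∼ φ)
□⇔□¬∼ φ = axiom (axDN1 φ) ⟨⇔⟩ ⇔-sym (□¬⇔□∼ (∼ φ))

□⇔□¬¬ : ∀ φ → ⊢ (□ φ ⇔ □ ¬' ¬' φ)
□⇔□¬¬ φ = axiom (axN5 φ) ⟨⇔⟩ ⇔-sym (□¬⇔□∼ (¬' φ))

□∼⇒¬ : ∀ φ → ⊢ (□ ∼ φ ⇒ ¬' φ)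
□∼⇒¬ φ = ⇒-trans (⇔-elimʳ (□¬⇔□∼ φ)) (axiom (axT (¬' φ)))

□¬∨⇔□¬∧¬ : ∀ φ ψ → ⊢ (□ ¬' (φ ∨' ψ) ⇔ □ (¬' φ ∧' ¬' ψ))
□¬∨⇔□¬∧¬ φ ψ =
  □¬⇔□∼ (φ ∨' ψ) ⟨⇔⟩ axiom (axN2 φ ψ) ⟨⇔⟩ axiom (axN1 (∼ φ) (∼ ψ))
  ⟨⇔⟩ ∧-cong (⇔-sym (□¬⇔□∼ φ)) (⇔-sym (□¬⇔□∼ ψ)) ⟨⇔⟩ ⇔-sym (axiom (axN1 (¬' φ) (¬' ψ)))

□¬⇒⇔□∧¬ : ∀ φ ψ → ⊢ (□ ¬' (φ ⇒ ψ) ⇔ □ (φ ∧' ¬' ψ))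
□¬⇒⇔□∧¬ φ ψ =
  □¬⇔□∼ (φ ⇒ ψ) ⟨⇔⟩ axiom (axK2 φ ψ)
  ⟨⇔⟩ ∧-cong (⇔-refl (□ φ)) (⇔-sym (□¬⇔□∼ ψ)) ⟨⇔⟩ ⇔-sym (axiom (axN1 φ (¬' ψ)))

□¬∨□¬⇒□¬∧ : ∀ φ ψ → ⊢ ((□ ¬' φ ∨' □ ¬' ψ) ⇒ □ ¬' (φ ∧' ψ))
□¬∨□¬⇒□¬∧ φ ψ =
  ⇒-trans (∨-mono (⇔-elimˡ (□¬⇔□∼ φ)) (⇔-elimˡ (□¬⇔□∼ ψ)))
          (⇒-trans (axiom (axN3 φ ψ)) (⇔-elimʳ (□¬⇔□∼ (φ ∧' ψ))))

□⇒¬∼ : ∀ φ → ⊢ (□ φ ⇒ ¬' ∼ φ)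
□⇒¬∼ φ = ⇒-trans (⇔-elimˡ (□⇔□¬∼ φ)) (axiom (axT (¬' ∼ φ)))

¬∼⇒∼□∼ : ∀ φ → ⊢ (¬' ∼ φ ⇒ ∼ □ ∼ φ)
¬∼⇒∼□∼ φ = ∼-contraposition (□⇒∼¬ (∼ φ))

mainTheorem5 : (φ ψ : Form) →
    (⊢ ((□ φ) ⇒ (∼ (¬' φ))))
    × (⊢ ((□ φ) ⇔ (□ (¬' (∼ φ)))))
    × (⊢ ((□ φ) ⇔ (□ (¬' (¬' φ)))))
    × (⊢ ((□ (¬' φ)) ⇔ (□ (∼ φ))))
    × (⊢ ((□ (∼ φ)) ⇒ (¬' φ)))
    × (⊢ ((□ (¬' (φ ∨' ψ))) ⇔ (□ ((¬' φ) ∧' (¬' ψ)))))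
    × (⊢ ((□ (¬' (φ ⇒ ψ))) ⇔ (□ (φ ∧' (¬' ψ)))))
    × (⊢ (((□ (¬' φ)) ∨' (□ (¬' ψ))) ⇒ (□ (¬' (φ ∧' ψ)))))
    × (⊢ ((□ φ) ⇒ (¬' (∼ φ))))
    × (⊢ ((¬' (∼ φ)) ⇒ (∼ (□ (∼ φ)))))
mainTheorem5 φ ψ =
    □⇒∼¬ φ , □⇔□¬∼ φ , □⇔□¬¬ φ , □¬⇔□∼ φ , □∼⇒¬ φ
  , □¬∨⇔□¬∧¬ φ ψ , □¬⇒⇔□∧¬ φ ψ , □¬∨□¬⇒□¬∧ φ ψ , □⇒¬∼ φ , ¬∼⇒∼□∼ φ
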